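{- Let $b\ge 2$. Let $H$ be any graph on $b-1$ vertices and $K$ a complete graph on $(b-1)^{b-1}$ vertices, vertex-disjoint from $H$, and let $G$ be the graph on $b+(b-1)^{b-1}$ vertices obtained from $H\cup K$ by adding a new vertex $v$ adjacent to all vertices of $H$ and of $K$. Then $src^\ell(G)=b$.
   Context: An edge-coloured path is rainbow if all its edges have distinct colours; a geodesic is a shortest path between its endpoints. An (not necessarily proper) edge-colouring of a connected graph is strongly rainbow connected if any two vertices are joined by a rainbow geodesic. An $r$-edge-list assignment of $G$ assigns to each edge $e$ a set $L(e)\subset\mathbb N$ with $|L(e)|\ge r$; an $L$-edge-colouring is an edge-colouring $c$ with $c(e)\in L(e)$ for all $e$. $src^\ell(G)$ is the minimum integer $r$ such that for every $r$-edge-list assignment $L$ of $G$ there exists a strongly rainbow connected $L$-edge-colouring of $G$. -}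

module Defs where

open import Data.Nat using (ℕ; zero; suc; _+_; _^_) renaming (_<_ to _<ℕ_)
open import Data.Fin using (Fin; zero; suc; splitAt; _<_)
open import Data.Fin.Properties using (<-cmp; _≟_)
open import Data.Bool using (Bool; true; false; not; T)
open import Data.Sum using (_⊎_; inj₁; inj₂)
open import Data.Product using (Σ; _×_; _,_)
open import Data.List using (List; []; _∷_; map)
open import Data.List.Relation.Unary.Unique.Propositional using (Unique)
open import Data.Empty using (⊥-elim)
open import Relation.Nullary using (¬_; yes; no)
open import Relation.Nullary.Decidable using (⌊_⌋)
open import Relation.Binary.Definitions using (tri<; tri≈; tri>)
open import Relation.Binary.PropositionalEquality using (_≡_; refl; sym; subst)
open import Function.Definitions using (Injective)

record SimpleGraph (n : ℕ) : Set where
  field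
    adj        : Fin n → Fin n → Bool
    adj-sym    : ∀ u v → adj u v ≡ adj v u
    adj-irrefl : ∀ u → adj u u ≡ false

module _ {n : ℕ} (G : SimpleGraph n) where
  open SimpleGraph G

  Edge : Set
  Edge = Σ (Fin n) λ u → Σ (Fin n) λ v → (u < v) × T (adj u v)

  toEdge : ∀ u v → T (adj u v) → Edge
  toEdge u v p with <-cmp u v
  ... | tri< lt _ _ = u , v , lt , p
  ... | tri≈ _ refl _ = ⊥-elim (subst T (adj-irrefl u) p)
  ... | tri> _ _ gt = v , u , gt , subst T (adj-sym u v) p

  data Walk : Fin n → Fin n → Set where
    []   : ∀ {u} → Walk u u
    step : ∀ {u} v {w} → T (adj u v) → Walk v w → Walk u w

  len : ∀ {u w} → Walk u w → ℕ
  len []             = zero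
  len (step _ _ q)   = suc (len q)

  vertices : ∀ {u w} → Walk u w → List (Fin n)
  vertices {u} []           = u ∷ []
  vertices {u} (step _ _ q) = u ∷ vertices q

  edges : ∀ {u w} → Walk u w → List Edge
  edges []               = []
  edges {u} (step v p q) = toEdge u v p ∷ edges q

  IsPath : ∀ {u w} → Walk u w → Set
  IsPath q = Unique (vertices q)

  IsGeodesic : ∀ {u w} → Walk u w → Set
  IsGeodesic {u} {w} q = IsPath q × (∀ (q' : Walk u w) → IsPath q' → Data.Nat._≤_ (len q) (len q'))

  Rainbow : (Edge → ℕ) → ∀ {u w} → Walk u w → Set
  Rainbow c q = Unique (map c (edges q))

  StronglyRainbowConnected : (Edge → ℕ) → Set
  StronglyRainbowConnected c =
    ∀ u w → Σ (Walk u w) λ q → IsGeodesic q × Rainbow c q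

  -- L(e) ⊆ ℕ with |L(e)| ≥ r: r distinct elements of L(e) exist.
  IsEdgeListAssignment : ℕ → (Edge → ℕ → Set) → Set
  IsEdgeListAssignment r L =
    ∀ e → Σ (Fin r → ℕ) λ f → Injective _≡_ _≡_ f × (∀ i → L e (f i))

  ListSRC : ℕ → Set₁
  ListSRC r = ∀ (L : Edge → ℕ → Set) → IsEdgeListAssignment r L →
    Σ (Edge → ℕ) λ c → (∀ e → L e (c e)) × StronglyRainbowConnected c

  SrcListIs : ℕ → Set₁
  SrcListIs r = ListSRC r × (∀ r' → r' <ℕ r → ¬ ListSRC r')

-- The graph G built from H (on a = b-1 vertices) and K = K_{a^a}:
-- vertex 0 is v; vertices suc i with i < a are H; the rest are K.
module Construction (a : ℕ) (H : SimpleGraph a) where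
  open SimpleGraph H renaming (adj to adjH)

  inner : Fin a ⊎ Fin (a ^ a) → Fin a ⊎ Fin (a ^ a) → Bool
  inner (inj₁ x) (inj₁ y) = adjH x y
  inner (inj₂ x) (inj₂ y) = not ⌊ x ≟ y ⌋
  inner (inj₁ _) (inj₂ _) = false
  inner (inj₂ _) (inj₁ _) = false

  inner-sym : ∀ s t → inner s t ≡ inner t s
  inner-sym (inj₁ x) (inj₁ y) = SimpleGraph.adj-sym H x y
  inner-sym (inj₂ x) (inj₂ y) with x ≟ y | y ≟ x
  ... | yes _ | yes _ = refl
  ... | no _  | no _  = refl
  ... | yes p | no q  = ⊥-elim (q (sym p))
  ... | no p  | yes q = ⊥-elim (p (sym q))
  inner-sym (inj₁ _) (inj₂ _) = refl
  inner-sym (inj₂ _) (inj₁ _) = refl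

  inner-irrefl : ∀ s → inner s s ≡ false
  inner-irrefl (inj₁ x) = SimpleGraph.adj-irrefl H x
  inner-irrefl (inj₂ x) with x ≟ x
  ... | yes _ = refl
  ... | no ¬p = ⊥-elim (¬p refl)

  adjG : Fin (suc (a + a ^ a)) → Fin (suc (a + a ^ a)) → Bool
  adjG zero    zero    = false
  adjG zero    (suc _) = true
  adjG (suc _) zero    = true
  adjG (suc i) (suc j) = inner (splitAt a i) (splitAt a j)

  adjG-sym : ∀ u v → adjG u v ≡ adjG v u
  adjG-sym zero    zero    = refl
  adjG-sym zero    (suc _) = refl
  adjG-sym (suc _) zero    = refl
  adjG-sym (suc i) (suc j) = inner-sym (splitAt a i) (splitAt a j)

  adjG-irrefl : ∀ u → adjG u u ≡ false
  adjG-irrefl zero    = refl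
  adjG-irrefl (suc i) = inner-irrefl (splitAt a i)

  G : SimpleGraph (suc (a + a ^ a))
  G = record { adj = adjG ; adj-sym = adjG-sym ; adj-irrefl = adjG-irrefl }

coneGraph : (a : ℕ) → SimpleGraph a → SimpleGraph (suc (a + a ^ a))
coneGraph a H = Construction.G a H

{-# OPTIONS --safe #-}
module Submission where

-- Every vertex of G other than the apex v is adjacent to v, so G has diameter 2
-- and a colouring is strongly rainbow connected as soon as any two
-- non-adjacent vertices x, y see differently coloured spokes vx, vy.
-- With lists of size b, colour the b - 1 spokes to H injectively and each
-- spoke to K avoiding those b - 1 colours.  With lists of size b - 1, index
-- the vertices of K by the functions k : V(H) → Fin (b - 1) and give the
-- spoke to h ∈ V(H) the colours (h , j) and the spoke to k the colours
-- (j , k j).  If a colouring picks (h , f h) on the spoke to h, the spoke to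
-- the vertex f of K repeats the colour of the spoke to some j ∈ V(H); but v
-- is the only common neighbour of j and f, so they have no rainbow geodesic.

open import Defs
open import Data.Nat using (ℕ; zero; suc; z≤n; s≤s; z<s; _≤_; _<_; _+_; _^_)
open import Data.Fin as Fin using (Fin; zero; suc; toℕ; splitAt; join; _↑ˡ_; _↑ʳ_; inject≤; combine; funToFin; finToFun)
open import Data.Fin.Properties
  using (pigeonhole; any?; ¬∀⟶∃¬; <⇒≢; suc-injective; toℕ-injective; combine-injective;
         inject≤-injective; join-splitAt; splitAt-join; finToFun-funToFin)
import Data.Nat.Properties as ℕ
open import Data.Bool using (true; false; T)
open import Data.Unit using (tt)
open import Data.Sum using (_⊎_; inj₁; inj₂)
open import Data.Product using (Σ; ∃; _×_; _,_; proj₁; proj₂)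
open import Data.List.Relation.Unary.All using ([]; _∷_)
open import Data.List.Relation.Unary.AllPairs using ([]; _∷_)
open import Data.Empty using (⊥; ⊥-elim)
open import Function using (_∘_)
open import Function.Definitions using (Injective)
open import Relation.Nullary using (¬_; yes; no)
open import Relation.Binary.Definitions using (DecidableEquality)
open import Relation.Binary.PropositionalEquality

module RainbowGeodesics {n : ℕ} (G : SimpleGraph n) where
  open SimpleGraph G

  RainbowGeodesic : (Edge G → ℕ) → Fin n → Fin n → Set
  RainbowGeodesic c u w = Σ (Walk G u w) λ q → IsGeodesic G q × Rainbow G c q

  RainbowTwoPath : (Edge G → ℕ) → Fin n → Fin n → Set
  RainbowTwoPath c u w =
    Σ (Fin n) λ x → Σ (T (adj u x)) λ p → Σ (T (adj x w)) λ p′ →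
      c (toEdge G u x p) ≢ c (toEdge G x w p′)

  adj⇒≢ : ∀ {u v} → T (adj u v) → u ≢ v
  adj⇒≢ {u} p refl = subst T (adj-irrefl u) p

  len-≢⇒≥1 : ∀ {u w} → u ≢ w → (q : Walk G u w) → 1 ≤ len G q
  len-≢⇒≥1 u≢w []           = ⊥-elim (u≢w refl)
  len-≢⇒≥1 u≢w (step _ _ _) = s≤s z≤n

  len-nonadjacent⇒≥2 : ∀ {u w} → u ≢ w → adj u w ≡ false → (q : Walk G u w) → 2 ≤ len G q
  len-nonadjacent⇒≥2 u≢w _  []                      = ⊥-elim (u≢w refl)
  len-nonadjacent⇒≥2 _   na (step _ p [])           = ⊥-elim (subst T na p)
  len-nonadjacent⇒≥2 _   _  (step _ _ (step _ _ _)) = s≤s (s≤s z≤n)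

  twoStep-isPath : ∀ {u x w} → u ≢ w → (p : T (adj u x)) (p′ : T (adj x w)) →
                   IsPath G (step x p (step w p′ []))
  twoStep-isPath u≢w p p′ = (adj⇒≢ p ∷ u≢w ∷ []) ∷ (adj⇒≢ p′ ∷ []) ∷ [] ∷ []

  rainbowGeodesic-refl : ∀ c u → RainbowGeodesic c u u
  rainbowGeodesic-refl c u = [] , ([] ∷ [] , λ _ _ → z≤n) , []

  rainbowGeodesic-edge : ∀ c {u w} → T (adj u w) → RainbowGeodesic c u w
  rainbowGeodesic-edge c p =
    step _ p [] , ((adj⇒≢ p ∷ []) ∷ [] ∷ [] , λ q _ → len-≢⇒≥1 (adj⇒≢ p) q) , [] ∷ []

  rainbowTwoPath⇒rainbowGeodesic : ∀ c {u w} → u ≢ w → adj u w ≡ false →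
                                   RainbowTwoPath c u w → RainbowGeodesic c u w
  rainbowTwoPath⇒rainbowGeodesic c u≢w na (x , p , p′ , distinct) =
    step x p (step _ p′ []) ,
    (twoStep-isPath u≢w p p′ , λ q _ → len-nonadjacent⇒≥2 u≢w na q) ,
    (distinct ∷ []) ∷ [] ∷ []

  rainbowWalk-≤2⇒rainbowTwoPath : ∀ c {u w} → u ≢ w → adj u w ≡ false → (q : Walk G u w) →
                                  len G q ≤ 2 → Rainbow G c q → RainbowTwoPath c u w
  rainbowWalk-≤2⇒rainbowTwoPath c u≢w _  []                  _ _ = ⊥-elim (u≢w refl)
  rainbowWalk-≤2⇒rainbowTwoPath c _   na (step _ p [])       _ _ = ⊥-elim (subst T na p)
  rainbowWalk-≤2⇒rainbowTwoPath c _   _  (step x p (step _ p′ [])) _ ((distinct ∷ []) ∷ _) =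
    x , p , p′ , distinct
  rainbowWalk-≤2⇒rainbowTwoPath c _   _  (step _ _ (step _ _ (step _ _ _))) (s≤s (s≤s ())) _

  rainbowGeodesic⇒rainbowTwoPath : ∀ c {u x w} → u ≢ w → adj u w ≡ false →
                                   T (adj u x) → T (adj x w) →
                                   RainbowGeodesic c u w → RainbowTwoPath c u w
  rainbowGeodesic⇒rainbowTwoPath c {x = x} u≢w na p p′ (q , (_ , shortest) , rainbow) =
    rainbowWalk-≤2⇒rainbowTwoPath c u≢w na q
      (shortest (step x p (step _ p′ [])) (twoStep-isPath u≢w p p′)) rainbow

  rainbowTwoPaths⇒src : ∀ c → (∀ u w → u ≢ w → adj u w ≡ false → RainbowTwoPath c u w) →
                        StronglyRainbowConnected G c
  rainbowTwoPaths⇒src c twoPath u w with u Fin.≟ w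
  ... | yes refl = rainbowGeodesic-refl c u
  ... | no u≢w with adj u w in eq
  ...   | true  = rainbowGeodesic-edge c (subst T (sym eq) tt)
  ...   | false = rainbowTwoPath⇒rainbowGeodesic c u≢w eq (twoPath u w u≢w eq)

module DistinctChoice {A : Set} (_≟_ : DecidableEquality A) where

  fresh : ∀ {m r} → m < r → (f : Fin r → A) → Injective _≡_ _≡_ f → (g : Fin m → A) →
          ∃ λ j → ∀ i → f j ≢ g i
  fresh {m} {r} m<r f f-inj g =
    let j , unhit = ¬∀⟶∃¬ r Hit (λ j → any? (λ i → f j ≟ g i)) allHit
    in  j , λ i eq → unhit (i , eq)
    where
    Hit : Fin r → Set
    Hit j = ∃ λ i → f j ≡ g i
    allHit : ¬ (∀ j → Hit j)
    allHit hit =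
      let j , j′ , j<j′ , same = pigeonhole m<r (proj₁ ∘ hit)
      in  <⇒≢ j<j′ (f-inj (trans (proj₂ (hit j)) (trans (cong g same) (sym (proj₂ (hit j′))))))

  distinctRepresentatives : ∀ {m r} → m ≤ r → (f : Fin m → Fin r → A) → (∀ i → Injective _≡_ _≡_ (f i)) →
                            Σ (Fin m → Fin r) λ choose → Injective _≡_ _≡_ (λ i → f i (choose i))
  distinctRepresentatives {zero}  _ _ _ = (λ ()) , λ { {()} }
  distinctRepresentatives {suc m} {r} m<r f f-inj = choose , choose-inj
    where
    rest : Σ (Fin m → Fin r) λ choose → Injective _≡_ _≡_ (λ i → f (suc i) (choose i))
    rest = distinctRepresentatives (ℕ.<⇒≤ m<r) (f ∘ suc) (f-inj ∘ suc)
    taken : Fin m → A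
    taken i = f (suc i) (proj₁ rest i)
    first : ∃ λ j → ∀ i → f zero j ≢ taken i
    first = fresh m<r (f zero) (f-inj zero) taken
    choose : Fin (suc m) → Fin r
    choose zero    = proj₁ first
    choose (suc i) = proj₁ rest i
    choose-inj : Injective _≡_ _≡_ (λ i → f i (choose i))
    choose-inj {zero}  {zero}  _  = refl
    choose-inj {zero}  {suc j} eq = ⊥-elim (proj₂ first j eq)
    choose-inj {suc i} {zero}  eq = ⊥-elim (proj₂ first i (sym eq))
    choose-inj {suc i} {suc j} eq = cong suc (proj₂ rest eq)

module Cone (a : ℕ) (H : SimpleGraph a) where
  open Construction a H using (inner; adjG)
  open RainbowGeodesics (coneGraph a H)
  open DistinctChoice ℕ._≟_

  N : ℕ
  N = a + a ^ a

  G : SimpleGraph (suc N)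
  G = coneGraph a H

  Side : Set
  Side = Fin a ⊎ Fin (a ^ a)

  vertex : Side → Fin (suc N)
  vertex s = suc (join a (a ^ a) s)

  splitAt-injective : ∀ {i j : Fin N} → splitAt a i ≡ splitAt a j → i ≡ j
  splitAt-injective {i} {j} eq = begin
    i                             ≡⟨ join-splitAt a (a ^ a) i ⟨
    join a (a ^ a) (splitAt a i)  ≡⟨ cong (join a (a ^ a)) eq ⟩
    join a (a ^ a) (splitAt a j)  ≡⟨ join-splitAt a (a ^ a) j ⟩
    j                             ∎
    where open ≡-Reasoning

  vertex-injective : Injective _≡_ _≡_ vertex
  vertex-injective {s} {t} eq = begin
    s                                  ≡⟨ splitAt-join a (a ^ a) s ⟨
    splitAt a (join a (a ^ a) s)       ≡⟨ cong (splitAt a) (suc-injective eq) ⟩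
    splitAt a (join a (a ^ a) t)       ≡⟨ splitAt-join a (a ^ a) t ⟩
    t                                  ∎
    where open ≡-Reasoning

  hVertex≢kVertex : ∀ h k → vertex (inj₁ h) ≢ vertex (inj₂ k)
  hVertex≢kVertex h k eq with vertex-injective {inj₁ h} {inj₂ k} eq
  ... | ()

  adj-vertex : ∀ s t → adjG (vertex s) (vertex t) ≡ inner s t
  adj-vertex s t = cong₂ inner (splitAt-join a (a ^ a) s) (splitAt-join a (a ^ a) t)

  spoke : Fin N → Edge G
  spoke i = zero , suc i , z<s , tt

  spoke-η : ∀ i p t → spoke i ≡ (zero , suc i , p , t)
  spoke-η i z<s _ = refl

  module Upper (L : Edge G → ℕ → Set) (L-size : IsEdgeListAssignment G (suc a) L) where
    options : Edge G → Fin (suc a) → ℕ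
    options e = proj₁ (L-size e)

    options-injective : ∀ e → Injective _≡_ _≡_ (options e)
    options-injective e = proj₁ (proj₂ (L-size e))

    options-∈ : ∀ e i → L e (options e i)
    options-∈ e = proj₂ (proj₂ (L-size e))

    hSpokes : Σ (Fin a → Fin (suc a)) λ choose →
                Injective _≡_ _≡_ (λ h → options (spoke (h ↑ˡ a ^ a)) (choose h))
    hSpokes = distinctRepresentatives (ℕ.n≤1+n a) (λ h → options (spoke (h ↑ˡ a ^ a)))
                (λ h → options-injective (spoke (h ↑ˡ a ^ a)))

    hColour : Fin a → ℕ
    hColour h = options (spoke (h ↑ˡ a ^ a)) (proj₁ hSpokes h)

    kSpoke : ∀ k → ∃ λ j → ∀ h → options (spoke (a ↑ʳ k)) j ≢ hColour h
    kSpoke k = fresh (ℕ.n<1+n a) (options (spoke (a ↑ʳ k))) (options-injective (spoke (a ↑ʳ k))) hColour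

    spokeColour : Side → ℕ
    spokeColour (inj₁ h) = hColour h
    spokeColour (inj₂ k) = options (spoke (a ↑ʳ k)) (proj₁ (kSpoke k))

    spokeColour-∈ : ∀ s → L (spoke (join a (a ^ a) s)) (spokeColour s)
    spokeColour-∈ (inj₁ h) = options-∈ _ (proj₁ hSpokes h)
    spokeColour-∈ (inj₂ k) = options-∈ _ (proj₁ (kSpoke k))

    spokeColour-nonadjacent : ∀ s t → s ≢ t → inner s t ≡ false → spokeColour s ≢ spokeColour t
    spokeColour-nonadjacent (inj₁ h) (inj₁ h′) h≢h′ _ eq = h≢h′ (cong inj₁ (proj₂ hSpokes eq))
    spokeColour-nonadjacent (inj₁ h) (inj₂ k) _ _ eq = proj₂ (kSpoke k) h (sym eq)
    spokeColour-nonadjacent (inj₂ k) (inj₁ h) _ _ eq = proj₂ (kSpoke k) h eq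
    spokeColour-nonadjacent (inj₂ k) (inj₂ k′) k≢k′ na _ with k Fin.≟ k′
    ... | yes k≡k′ = k≢k′ (cong inj₂ k≡k′)
    spokeColour-nonadjacent (inj₂ k) (inj₂ k′) k≢k′ () _ | no _

    colouring : Edge G → ℕ
    colouring (zero , suc i , _ , _) = spokeColour (splitAt a i)
    colouring e                      = options e zero

    colouring-∈ : ∀ e → L e (colouring e)
    colouring-∈ (zero , zero , () , _)
    colouring-∈ (zero , suc i , p , t) =
      subst (λ e → L e (spokeColour (splitAt a i)))
            (trans (cong spoke (join-splitAt a (a ^ a) i)) (spoke-η i p t))
            (spokeColour-∈ (splitAt a i))
    colouring-∈ (suc _ , _ , _ , _) = options-∈ _ zero

    colouring-src : StronglyRainbowConnected G colouring
    colouring-src = rainbowTwoPaths⇒src colouring viaApex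
      where
      viaApex : ∀ u w → u ≢ w → adjG u w ≡ false → RainbowTwoPath colouring u w
      viaApex zero    zero    u≢w _ = ⊥-elim (u≢w refl)
      viaApex zero    (suc _) _   ()
      viaApex (suc _) zero    _   ()
      viaApex (suc i) (suc j) u≢w na =
        zero , tt , tt ,
        spokeColour-nonadjacent _ _ (u≢w ∘ cong suc ∘ splitAt-injective) na

  listSRC : ListSRC G (suc a)
  listSRC L L-size = colouring , colouring-∈ , colouring-src
    where open Upper L L-size

  pair : Fin a → Fin a → ℕ
  pair x y = toℕ (combine x y)

  pair-injective : ∀ {x y x′ y′} → pair x y ≡ pair x′ y′ → x ≡ x′ × y ≡ y′
  pair-injective {x} {y} {x′} {y′} eq = combine-injective x y x′ y′ (toℕ-injective eq)

  -- The vertex k of K stands for the function finToFun k : Fin a → Fin a.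
  trapSide : Side → Fin a → ℕ
  trapSide (inj₁ h) j = pair h j
  trapSide (inj₂ k) j = pair j (finToFun k j)

  trap : Edge G → Fin a → ℕ
  trap (zero , suc i , _ , _) = trapSide (splitAt a i)
  trap _                      = toℕ

  trap-injective : ∀ e → Injective _≡_ _≡_ (trap e)
  trap-injective (zero , zero , () , _)
  trap-injective (zero , suc i , _ , _) with splitAt a i
  ... | inj₁ h = proj₂ ∘ pair-injective
  ... | inj₂ k = proj₁ ∘ pair-injective
  trap-injective (suc _ , _ , _ , _) = toℕ-injective

  trap-spoke : ∀ s → trap (spoke (join a (a ^ a) s)) ≡ trapSide s
  trap-spoke s = cong trapSide (splitAt-join a (a ^ a) s)

  Trap : Edge G → ℕ → Set
  Trap e x = ∃ λ j → trap e j ≡ x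

  Trap-size : ∀ {r} → r ≤ a → IsEdgeListAssignment G r Trap
  Trap-size r≤a e =
    (λ i → trap e (inject≤ i r≤a)) ,
    (λ eq → inject≤-injective r≤a r≤a _ _ (trap-injective e eq)) ,
    (λ i → inject≤ i r≤a , refl)

  inner-noCommonNeighbour : ∀ h k s → T (inner (inj₁ h) s) → T (inner s (inj₂ k)) → ⊥
  inner-noCommonNeighbour h k (inj₁ _) _ ()
  inner-noCommonNeighbour h k (inj₂ _) () _

  noRainbowTwoPath : ∀ c h k → c (spoke (h ↑ˡ a ^ a)) ≡ c (spoke (a ↑ʳ k)) →
                     ¬ RainbowTwoPath c (vertex (inj₁ h)) (vertex (inj₂ k))
  -- At the apex, toEdge computes to the two spokes.
  noRainbowTwoPath c h k clash (zero , _ , _ , distinct) = distinct clash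
  noRainbowTwoPath c h k clash (suc y , p , p′ , _) =
    inner-noCommonNeighbour h k (splitAt a y)
      (subst (λ s → T (inner s (splitAt a y))) (splitAt-join a (a ^ a) (inj₁ h)) p)
      (subst (λ s → T (inner (splitAt a y) s)) (splitAt-join a (a ^ a) (inj₂ k)) p′)

  Trap-¬src : ∀ c → (∀ e → Trap e (c e)) → ¬ StronglyRainbowConnected G c
  Trap-¬src c c-∈ src =
    noRainbowTwoPath c j k clash
      (rainbowGeodesic⇒rainbowTwoPath c {x = zero} (hVertex≢kVertex j k)
        (adj-vertex (inj₁ j) (inj₂ k)) tt tt (src _ _))
    where
    spokeChoice : ∀ s → ∃ λ j → trapSide s j ≡ c (spoke (join a (a ^ a) s))
    spokeChoice s = subst (λ o → ∃ λ j → o j ≡ c (spoke (join a (a ^ a) s)))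
                          (trap-spoke s) (c-∈ (spoke (join a (a ^ a) s)))
    f : Fin a → Fin a
    f h = proj₁ (spokeChoice (inj₁ h))
    k : Fin (a ^ a)
    k = funToFin f
    j : Fin a
    j = proj₁ (spokeChoice (inj₂ k))
    clash : c (spoke (j ↑ˡ a ^ a)) ≡ c (spoke (a ↑ʳ k))
    clash = begin
      c (spoke (j ↑ˡ a ^ a))  ≡⟨ proj₂ (spokeChoice (inj₁ j)) ⟨
      pair j (f j)            ≡⟨ cong (pair j) (finToFun-funToFin f j) ⟨
      pair j (finToFun k j)   ≡⟨ proj₂ (spokeChoice (inj₂ k)) ⟩
      c (spoke (a ↑ʳ k))      ∎
      where open ≡-Reasoning

  ¬listSRC : ∀ r → r < suc a → ¬ ListSRC G r
  ¬listSRC r r<1+a srcᵣ =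
    let c , c-∈ , c-src = srcᵣ Trap (Trap-size (ℕ.≤-pred r<1+a))
    in  Trap-¬src c c-∈ c-src

lemma4p4 : (a : ℕ) → 1 ≤ a → (H : SimpleGraph a) →
    SrcListIs (coneGraph a H) (suc a)
lemma4p4 a _ H = Cone.listSRC a H , Cone.¬listSRC a H
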